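{- If $G = (X, Y, E)$ is a finite bipartite graph with parts $X$ and $Y$, then $G$ admits a TLIR coloring with the two colors red and blue such that every edge is red, every $x \in X$ has even total red-degree, and every $y \in Y$ has odd total red-degree.
   Context: A total coloring of $G$ assigns a color to every vertex and every edge. For a color $c$ and a vertex $v$, the total $c$-degree of $v$ is the number of edges of color $c$ incident to $v$, plus $1$ if $v$ has color $c$. A total coloring is a locally irregular total coloring (TLIR coloring) if for every edge $uv$, with $c$ the color of $uv$, the total $c$-degrees of $u$ and $v$ differ. -}

module Defs where

open import Data.Nat using (ℕ; zero; suc; _+_)
open import Data.Nat.Divisibility using (_∣_)
open import Relation.Nullary using (¬_)
open import Data.Bool using (Bool; true; false; _∧_; if_then_else_)
open import Data.Fin using (Fin)
open import Data.List using (List; map; allFin)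
open import Data.Nat.ListAction using (sum)
open import Relation.Binary.PropositionalEquality using (_≡_; _≢_)
open import Relation.Nullary.Decidable using (⌊_⌋)

data Color : Set where
  red blue : Color

_≟c_ : Color → Color → Bool
red  ≟c red  = true
blue ≟c blue = true
_    ≟c _    = false

-- A finite (simple) bipartite graph G = (X, Y, E) with X = Fin m, Y = Fin n,
-- given by its bipartite adjacency relation: adj x y = true iff xy ∈ E.
record BipGraph : Set where
  field
    m n : ℕ
    adj : Fin m → Fin n → Bool

-- A total coloring with colors red/blue: every vertex of X, every vertex of Y
-- and every (potential) edge gets a color; colors of non-edges are irrelevant.
record TotalColoring (G : BipGraph) : Set where
  open BipGraph G
  field
    colX : Fin m → Color
    colY : Fin n → Color
    colE : Fin m → Fin n → Color

Even : ℕ → Set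
Even d = 2 ∣ d

Odd : ℕ → Set
Odd d = ¬ (2 ∣ d)

indicator : Bool → ℕ
indicator true  = 1
indicator false = 0

module _ {G : BipGraph} (φ : TotalColoring G) where
  open BipGraph G
  open TotalColoring φ

  degX : Color → Fin m → ℕ
  degX c x = sum (map (λ y → indicator (adj x y ∧ (colE x y ≟c c))) (allFin n))
             + indicator (colX x ≟c c)

  degY : Color → Fin n → ℕ
  degY c y = sum (map (λ x → indicator (adj x y ∧ (colE x y ≟c c))) (allFin m))
             + indicator (colY y ≟c c)

  IsTLIR : Set
  IsTLIR = ∀ (x : Fin m) (y : Fin n) → adj x y ≡ true →
           degX (colE x y) x ≢ degY (colE x y) y

-- Colour every edge red. Then the total red-degree of a vertex is its graph degree
-- plus one exactly when the vertex itself is red, so colouring a vertex red or blue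
-- sets the parity of its total red-degree at will: even on X, odd on Y. Every edge
-- then joins an even and an odd total red-degree, which therefore differ.
module Submission where

open import Defs
open import Data.Bool using (Bool; true; false; _∧_)
open import Data.Fin using (Fin)
open import Data.List using (map; allFin)
open import Data.Nat using (ℕ; zero; suc; _+_)
open import Data.Nat.Divisibility using (_∣_; divides; ∣-refl; ∣m∣n⇒∣m+n; ∣m+n∣m⇒∣n; ∣1⇒≡1)
open import Data.Nat.ListAction using (sum)
open import Data.Nat.Properties using (+-comm; +-identityʳ)
open import Data.Product using (Σ; _×_; _,_; proj₁; proj₂)
open import Data.Sum using (_⊎_; inj₁; inj₂)
open import Relation.Binary.PropositionalEquality using (_≡_; refl; sym; subst)

even⊎even-suc : ∀ k → Even k ⊎ Even (suc k)
even⊎even-suc zero    = inj₁ (divides 0 refl)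
even⊎even-suc (suc k) with even⊎even-suc k
... | inj₁ even-k   = inj₂ (∣m∣n⇒∣m+n ∣-refl even-k)
... | inj₂ even-1+k = inj₁ even-1+k

even⇒odd-suc : ∀ {k} → Even k → Odd (suc k)
even⇒odd-suc {k} even-k even-1+k
  with ∣1⇒≡1 (∣m+n∣m⇒∣n (subst Even (+-comm 1 k) even-1+k) even-k)
... | ()

even-padding : ∀ k → Σ Bool λ b → Even (k + indicator b)
even-padding k with even⊎even-suc k
... | inj₁ even-k   = false , subst Even (sym (+-identityʳ k)) even-k
... | inj₂ even-1+k = true  , subst Even (+-comm 1 k) even-1+k

odd-padding : ∀ k → Σ Bool λ b → Odd (k + indicator b)
odd-padding k with even⊎even-suc k
... | inj₁ even-k   = true  , λ even-k+1 →
  even⇒odd-suc even-k (subst Even (+-comm k 1) even-k+1)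
... | inj₂ even-1+k = false , λ even-k+0 →
  even⇒odd-suc (subst Even (+-identityʳ k) even-k+0) even-1+k

redIf : Bool → Color
redIf true  = red
redIf false = blue

redIf-≟c-red : ∀ b → (redIf b ≟c red) ≡ b
redIf-≟c-red true  = refl
redIf-≟c-red false = refl

proposition1 : (G : BipGraph) →
    Σ (TotalColoring G) λ φ →
      IsTLIR φ
      × (∀ (x : Fin (BipGraph.m G)) (y : Fin (BipGraph.n G)) →
           BipGraph.adj G x y ≡ true → TotalColoring.colE φ x y ≡ red)
      × (∀ (x : Fin (BipGraph.m G)) → Even (degX φ red x))
      × (∀ (y : Fin (BipGraph.n G)) → Odd (degY φ red y))
proposition1 G = φ , irregular , (λ _ _ _ → refl) , evenX , oddY
  where
  open BipGraph G

  -- the shape degX φ red and degY φ red reduce to once every edge is red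
  redEdgesX : Fin m → ℕ
  redEdgesX x = sum (map (λ y → indicator (adj x y ∧ true)) (allFin n))

  redEdgesY : Fin n → ℕ
  redEdgesY y = sum (map (λ x → indicator (adj x y ∧ true)) (allFin m))

  φ : TotalColoring G
  φ = record
    { colX = λ x → redIf (proj₁ (even-padding (redEdgesX x)))
    ; colY = λ y → redIf (proj₁ (odd-padding (redEdgesY y)))
    ; colE = λ _ _ → red
    }

  evenX : ∀ x → Even (degX φ red x)
  evenX x with even-padding (redEdgesX x)
  ... | b , even = subst (λ c → Even (redEdgesX x + indicator c)) (sym (redIf-≟c-red b)) even

  oddY : ∀ y → Odd (degY φ red y)
  oddY y with odd-padding (redEdgesY y)
  ... | b , odd = subst (λ c → Odd (redEdgesY y + indicator c)) (sym (redIf-≟c-red b)) odd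

  irregular : IsTLIR φ
  irregular x y _ same = oddY y (subst Even same (evenX x))
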